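{- Every extension of the Gentzen relation $G\mathcal{B}$ (every finitary extension of $G\mathcal{B}$) may be axiomatized as an extension of the calculus $G\mathcal{B}$ by a set of structural rules (respectively, by a set of finitary structural rules).
   Context: Formulas are built from a set of propositional atoms using $\wedge,\vee$, the unary ${ - }$ and constants $\top,\bot$. A sequent $\Gamma\vartriangleright\Delta$ is a pair of finite multisets of formulas; atomic if all its formulas are atoms. The calculus $G\mathcal{B}$ consists of: Introduction rules: from $\Gamma\vartriangleright\Delta,\varphi$ and $\Gamma\vartriangleright\Delta,\psi$ infer $\Gamma\vartriangleright\Delta,\varphi\wedge\psi$; from $\varphi,\psi,\Gamma\vartriangleright\Delta$ infer $\varphi\wedge\psi,\Gamma\vartriangleright\Delta$; from $\varphi,\Gamma\vartriangleright\Delta$ and $\psi,\Gamma\vartriangleright\Delta$ infer $\varphi\vee\psi,\Gamma\vartriangleright\Delta$; from $\Gamma\vartriangleright\Delta,\varphi,\psi$ infer $\Gamma\vartriangleright\Delta,\varphi\vee\psi$; from $\varphi,\Gamma\vartriangleright\Delta$ infer $\Gamma\vartriangleright\Delta,{ - }\varphi$; from $\Gamma\vartriangleright\Delta,\varphi$ infer ${ - }\varphi,\Gamma\vartriangleright\Delta$; axioms $\emptyset\vartriangleright\top$ and $\bot\vartriangleright\emptyset$. Elimination rules: the inverses of the two-directional rules above (e.g. from $\Gamma\vartriangleright\Delta,\varphi\wedge\psi$ infer $\Gamma\vartriangleright\Delta,\varphi$ and also $\Gamma\vartriangleright\Delta,\psi$; from $\varphi\vee\psi,\Gamma\vartriangleright\Delta$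 infer $\varphi,\Gamma\vartriangleright\Delta$ and also $\psi,\Gamma\vartriangleright\Delta$; similarly for the other connectives), plus: from $\top,\Gamma\vartriangleright\Delta$ infer $\Gamma\vartriangleright\Delta$; from $\Gamma\vartriangleright\Delta,\bot$ infer $\Gamma\vartriangleright\Delta$. Structural rules: Weakening (add a formula on either side) and Contraction (remove a duplicate formula on either side). A Gentzen relation is a relation $\vdash$ between sets of sequents and sequents such that $s\vdash s$; $S\vdash s$ implies $S\cup S'\vdash s$; if $S\vdash t$ for all $t\in T$ and $T\cup S'\vdash s$ then $S\cup S'\vdash s$; and $S\vdash s$ implies $\sigma[S]\vdash\sigma(s)$ for every substitution $\sigma$ (applied to all formulas). It is finitary if $S\vdash s$ implies $S'\vdash s$ for some finite $S'\subseteq S$. A rule is a pair (set of premise sequents, conclusion sequent); it is finitary if it has finitely many premises. A set of rules axiomatizes the least Gentzen relation containing all of them; $G\mathcal{B}$ also denotes the Gentzen relation axiomatized by the calculus $G\mathcal{B}$, and an extension of $G\mathcal{B}$ is a Gentzen relation containing it. A structural rule is a rule in which no connective or constant occurs, i.e. whose premises and conclusion are atomic sequents (it is applied in all its substitution instances). -}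

module Defs where

open import Level using (Level; 0ℓ) renaming (suc to lsuc)
open import Data.Nat using (ℕ)
open import Data.List using (List; []; _∷_; _++_)
open import Data.List.Membership.Propositional using (_∈_)
open import Data.List.Relation.Unary.All using (All)
open import Data.List.Relation.Binary.Permutation.Propositional using (_↭_)
open import Data.Product using (Σ; ∃; _×_; _,_)
open import Data.Sum using (_⊎_)
open import Relation.Binary.PropositionalEquality using (_≡_)

Atom : Set
Atom = ℕ

data Formula : Set where
  atom : Atom → Formula
  _∧′_ : Formula → Formula → Formula
  _∨′_ : Formula → Formula → Formula
  ─_   : Formula → Formula
  ⊤′   : Formula
  ⊥′   : Formula

infixr 6 _∧′_
infixr 5 _∨′_

-- Sequents: pairs of finite multisets, represented as pairs of lists;
-- the multiset reading is enforced by the exchange rule of GB below.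

record Sequent : Set where
  constructor _▷_
  field
    ante : List Formula
    succ : List Formula
open Sequent public

infix 4 _▷_

Subst : Set
Subst = Atom → Formula

substF : Subst → Formula → Formula
substF σ (atom a) = σ a
substF σ (φ ∧′ ψ) = substF σ φ ∧′ substF σ ψ
substF σ (φ ∨′ ψ) = substF σ φ ∨′ substF σ ψ
substF σ (─ φ)    = ─ substF σ φ
substF σ ⊤′       = ⊤′
substF σ ⊥′       = ⊥′

substL : Subst → List Formula → List Formula
substL σ []       = []
substL σ (φ ∷ Γ) = substF σ φ ∷ substL σ Γ

substS : Subst → Sequent → Sequent
substS σ (Γ ▷ Δ) = substL σ Γ ▷ substL σ Δ

SeqSet : Set₁
SeqSet = Sequent → Set

_⊆ₛ_ : SeqSet → SeqSet → Set
S ⊆ₛ S′ = ∀ t → S t → S′ t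

_∪ₛ_ : SeqSet → SeqSet → SeqSet
(S ∪ₛ S′) t = S t ⊎ S′ t

｛_｝ : Sequent → SeqSet
｛ s ｝ t = t ≡ s

_[_]ₛ : Subst → SeqSet → SeqSet
(σ [ S ]ₛ) t = Σ Sequent λ u → S u × (t ≡ substS σ u)

fromList : List Sequent → SeqSet
fromList L t = t ∈ L

Relation : Set₂
Relation = SeqSet → Sequent → Set₁

record IsGentzen (_⊢_ : Relation) : Set₁ where
  field
    reflexive  : ∀ s → ｛ s ｝ ⊢ s
    -- S ⊢ s implies S ∪ S′ ⊢ s  (stated for any superset, i.e. up to extensional equality of sets)
    monotone   : ∀ {S S′ s} → S ⊢ s → S ⊆ₛ S′ → S′ ⊢ s
    cut        : ∀ {S S′ T s} → (∀ t → T t → S ⊢ t) → (T ∪ₛ S′) ⊢ s → (S ∪ₛ S′) ⊢ s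
    structural : ∀ {S s} (σ : Subst) → S ⊢ s → (σ [ S ]ₛ) ⊢ substS σ s

Finitary : Relation → Set₁
Finitary _⊢_ = ∀ {S s} → S ⊢ s →
  Σ (List Sequent) λ L → (fromList L ⊆ₛ S) × (fromList L ⊢ s)

record Rule : Set₁ where
  constructor rule
  field
    premises   : SeqSet
    conclusion : Sequent
open Rule public

mkRule : List Sequent → Sequent → Rule
mkRule L c = rule (fromList L) c

FinitaryRule : Rule → Set
FinitaryRule r = Σ (List Sequent) λ L → premises r ⊆ₛ fromList L

-- a set of rules is a family of rules indexed by some type
Contains : {I : Set₁} → (I → Rule) → Relation → Set₁
Contains rs _⊢_ = ∀ i → premises (rs i) ⊢ conclusion (rs i)

Axiomatizes : {I : Set₁} → (I → Rule) → Relation → Set₂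
Axiomatizes rs _⊢_ =
  IsGentzen _⊢_ × Contains rs _⊢_ ×
  (∀ (_⊢′_ : Relation) → IsGentzen _⊢′_ → Contains rs _⊢′_ →
     ∀ S s → S ⊢ s → S ⊢′ s)

IsAtom : Formula → Set
IsAtom φ = Σ Atom λ a → φ ≡ atom a

AtomicSeq : Sequent → Set
AtomicSeq (Γ ▷ Δ) = All IsAtom Γ × All IsAtom Δ

StructuralRule : Rule → Set
StructuralRule r = (∀ t → premises r t → AtomicSeq t) × AtomicSeq (conclusion r)

-- The calculus GB (the principal formula is written at the head of a list)

data GBIdx : Set₁ where
  ∧R ∧L ∨L ∨R : (Γ Δ : List Formula) (φ ψ : Formula) → GBIdx
  ─R ─L       : (Γ Δ : List Formula) (φ : Formula) → GBIdx
  ⊤ax ⊥ax     : GBIdx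
  ∧R-e₁ ∧R-e₂ ∧L-e ∨L-e₁ ∨L-e₂ ∨R-e : (Γ Δ : List Formula) (φ ψ : Formula) → GBIdx
  ─R-e ─L-e   : (Γ Δ : List Formula) (φ : Formula) → GBIdx
  ⊤-e ⊥-e     : (Γ Δ : List Formula) → GBIdx
  WL WR CL CR : (Γ Δ : List Formula) (φ : Formula) → GBIdx
  Ex          : (Γ Δ Γ′ Δ′ : List Formula) → Γ ↭ Γ′ → Δ ↭ Δ′ → GBIdx

GB : GBIdx → Rule
GB (∧R Γ Δ φ ψ) = mkRule ((Γ ▷ φ ∷ Δ) ∷ (Γ ▷ ψ ∷ Δ) ∷ []) (Γ ▷ (φ ∧′ ψ) ∷ Δ)
GB (∧L Γ Δ φ ψ) = mkRule ((φ ∷ ψ ∷ Γ ▷ Δ) ∷ []) ((φ ∧′ ψ) ∷ Γ ▷ Δ)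
GB (∨L Γ Δ φ ψ) = mkRule ((φ ∷ Γ ▷ Δ) ∷ (ψ ∷ Γ ▷ Δ) ∷ []) ((φ ∨′ ψ) ∷ Γ ▷ Δ)
GB (∨R Γ Δ φ ψ) = mkRule ((Γ ▷ φ ∷ ψ ∷ Δ) ∷ []) (Γ ▷ (φ ∨′ ψ) ∷ Δ)
GB (─R Γ Δ φ)   = mkRule ((φ ∷ Γ ▷ Δ) ∷ []) (Γ ▷ (─ φ) ∷ Δ)
GB (─L Γ Δ φ)   = mkRule ((Γ ▷ φ ∷ Δ) ∷ []) ((─ φ) ∷ Γ ▷ Δ)
GB ⊤ax          = mkRule [] ([] ▷ ⊤′ ∷ [])
GB ⊥ax          = mkRule [] (⊥′ ∷ [] ▷ [])
GB (∧R-e₁ Γ Δ φ ψ) = mkRule ((Γ ▷ (φ ∧′ ψ) ∷ Δ) ∷ []) (Γ ▷ φ ∷ Δ)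
GB (∧R-e₂ Γ Δ φ ψ) = mkRule ((Γ ▷ (φ ∧′ ψ) ∷ Δ) ∷ []) (Γ ▷ ψ ∷ Δ)
GB (∧L-e Γ Δ φ ψ)  = mkRule (((φ ∧′ ψ) ∷ Γ ▷ Δ) ∷ []) (φ ∷ ψ ∷ Γ ▷ Δ)
GB (∨L-e₁ Γ Δ φ ψ) = mkRule (((φ ∨′ ψ) ∷ Γ ▷ Δ) ∷ []) (φ ∷ Γ ▷ Δ)
GB (∨L-e₂ Γ Δ φ ψ) = mkRule (((φ ∨′ ψ) ∷ Γ ▷ Δ) ∷ []) (ψ ∷ Γ ▷ Δ)
GB (∨R-e Γ Δ φ ψ)  = mkRule ((Γ ▷ (φ ∨′ ψ) ∷ Δ) ∷ []) (Γ ▷ φ ∷ ψ ∷ Δ)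
GB (─R-e Γ Δ φ)    = mkRule ((Γ ▷ (─ φ) ∷ Δ) ∷ []) (φ ∷ Γ ▷ Δ)
GB (─L-e Γ Δ φ)    = mkRule (((─ φ) ∷ Γ ▷ Δ) ∷ []) (Γ ▷ φ ∷ Δ)
GB (⊤-e Γ Δ)       = mkRule ((⊤′ ∷ Γ ▷ Δ) ∷ []) (Γ ▷ Δ)
GB (⊥-e Γ Δ)       = mkRule ((Γ ▷ ⊥′ ∷ Δ) ∷ []) (Γ ▷ Δ)
GB (WL Γ Δ φ)      = mkRule ((Γ ▷ Δ) ∷ []) (φ ∷ Γ ▷ Δ)
GB (WR Γ Δ φ)      = mkRule ((Γ ▷ Δ) ∷ []) (Γ ▷ φ ∷ Δ)
GB (CL Γ Δ φ)      = mkRule ((φ ∷ φ ∷ Γ ▷ Δ) ∷ []) (φ ∷ Γ ▷ Δ)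
GB (CR Γ Δ φ)      = mkRule ((Γ ▷ φ ∷ φ ∷ Δ) ∷ []) (Γ ▷ φ ∷ Δ)
GB (Ex Γ Δ Γ′ Δ′ _ _) = mkRule ((Γ ▷ Δ) ∷ []) (Γ′ ▷ Δ′)

ExtensionOfGB : Relation → Set₁
ExtensionOfGB _⊢_ = IsGentzen _⊢_ × Contains GB _⊢_

GB+ : {I : Set₁} → (I → Rule) → (GBIdx ⊎ I → Rule)
GB+ rs (Data.Sum.inj₁ g) = GB g
GB+ rs (Data.Sum.inj₂ i) = rs i

-- The logical rules of GB come together with their inverses, so decomposing a sequent
-- bottom-up along them (using exchange to set aside the atoms reached) turns it into a
-- finite list of atomic sequents interderivable with it in every extension of GB.  An
-- extension ⊢ is therefore axiomatized over GB by the structural rules "atomic reducts of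
-- S / t", one for each S ⊢ s and each atomic reduct t of s; these rules are finitary when
-- S may be taken finite.

module Submission where

open import Defs
open import Data.Product using (Σ; _×_; _,_; proj₁; proj₂)
open import Function using (_∘_)
open import Data.Empty using (⊥)
open import Data.Sum using (inj₁; inj₂; [_,_]′)
open import Data.List using (List; []; _∷_; _++_; map; concatMap)
open import Data.List.Properties using (++-identityʳ)
open import Data.List.Membership.Propositional using (_∈_)
open import Data.List.Membership.Propositional.Properties
  using (∈-++⁺ˡ; ∈-++⁺ʳ; ∈-++⁻; ∈-concatMap⁺)
open import Data.List.Relation.Unary.Any using (here; there)
import Data.List.Relation.Unary.Any as Any
open import Data.List.Relation.Unary.All using (All; []; _∷_)
open import Data.List.Relation.Binary.Permutation.Propositional using (↭-refl; ↭-sym; ↭-reflexive)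
open import Data.List.Relation.Binary.Permutation.Propositional.Properties using (shift; ++-comm)
open import Relation.Binary.PropositionalEquality using (_≡_; refl; subst; cong₂)

atoms : List Atom → List Formula
atoms = map atom

atoms-atomic : ∀ A → All IsAtom (atoms A)
atoms-atomic []      = []
atoms-atomic (a ∷ A) = (a , refl) ∷ atoms-atomic A

-- A continuation receives the atoms already split off to the left and to the right.
Continuation : Set
Continuation = List Atom → List Atom → List Sequent

mutual
  reduceL : Formula → Continuation → Continuation
  reduceL (atom a) k A B = k (a ∷ A) B
  reduceL (φ ∧′ ψ) k     = reduceL φ (reduceL ψ k)
  reduceL (φ ∨′ ψ) k A B = reduceL φ k A B ++ reduceL ψ k A B
  reduceL (─ φ)    k     = reduceR φ k
  reduceL ⊤′       k     = k
  reduceL ⊥′       k A B = []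

  reduceR : Formula → Continuation → Continuation
  reduceR (atom a) k A B = k A (a ∷ B)
  reduceR (φ ∧′ ψ) k A B = reduceR φ k A B ++ reduceR ψ k A B
  reduceR (φ ∨′ ψ) k     = reduceR φ (reduceR ψ k)
  reduceR (─ φ)    k     = reduceL φ k
  reduceR ⊤′       k A B = []
  reduceR ⊥′       k     = k

reduceLs : List Formula → Continuation → Continuation
reduceLs []      k = k
reduceLs (φ ∷ Γ) k = reduceL φ (reduceLs Γ k)

reduceRs : List Formula → Continuation → Continuation
reduceRs []      k = k
reduceRs (φ ∷ Δ) k = reduceR φ (reduceRs Δ k)

atomicLeaf : Continuation
atomicLeaf A B = (atoms A ▷ atoms B) ∷ []

atomicReducts : Sequent → List Sequent
atomicReducts (Γ ▷ Δ) = reduceLs Γ (reduceRs Δ atomicLeaf) [] []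

atomicReductsOf : SeqSet → SeqSet
atomicReductsOf S t = Σ Sequent λ s → S s × t ∈ atomicReducts s

atomicReductsOf-fromList : ∀ L → atomicReductsOf (fromList L) ⊆ₛ fromList (concatMap atomicReducts L)
atomicReductsOf-fromList L t (s , s∈L , t∈s) = ∈-concatMap⁺ atomicReducts (Any.map (λ { refl → t∈s }) s∈L)

AtomicOutput : Continuation → Set
AtomicOutput k = ∀ A B t → t ∈ k A B → AtomicSeq t

mutual
  reduceL-atomic : ∀ φ {k} → AtomicOutput k → AtomicOutput (reduceL φ k)
  reduceL-atomic (atom a) h A B   = h (a ∷ A) B
  reduceL-atomic (φ ∧′ ψ) h       = reduceL-atomic φ (reduceL-atomic ψ h)
  reduceL-atomic (φ ∨′ ψ) h A B t m =
    [ reduceL-atomic φ h A B t , reduceL-atomic ψ h A B t ]′ (∈-++⁻ _ m)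
  reduceL-atomic (─ φ)    h       = reduceR-atomic φ h
  reduceL-atomic ⊤′       h       = h
  reduceL-atomic ⊥′       h A B t ()

  reduceR-atomic : ∀ φ {k} → AtomicOutput k → AtomicOutput (reduceR φ k)
  reduceR-atomic (atom a) h A B   = h A (a ∷ B)
  reduceR-atomic (φ ∧′ ψ) h A B t m =
    [ reduceR-atomic φ h A B t , reduceR-atomic ψ h A B t ]′ (∈-++⁻ _ m)
  reduceR-atomic (φ ∨′ ψ) h       = reduceR-atomic φ (reduceR-atomic ψ h)
  reduceR-atomic (─ φ)    h       = reduceL-atomic φ h
  reduceR-atomic ⊤′       h A B t ()
  reduceR-atomic ⊥′       h       = h

atomicReducts-atomic : ∀ s t → t ∈ atomicReducts s → AtomicSeq t
atomicReducts-atomic (Γ ▷ Δ) = reduceLs-atomic Γ (reduceRs-atomic Δ atomicLeaf-atomic) [] []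
  where
  atomicLeaf-atomic : AtomicOutput atomicLeaf
  atomicLeaf-atomic A B _ (here refl) = atoms-atomic A , atoms-atomic B

  reduceRs-atomic : ∀ Δ {k} → AtomicOutput k → AtomicOutput (reduceRs Δ k)
  reduceRs-atomic []      h = h
  reduceRs-atomic (φ ∷ Δ) h = reduceR-atomic φ (reduceRs-atomic Δ h)

  reduceLs-atomic : ∀ Γ {k} → AtomicOutput k → AtomicOutput (reduceLs Γ k)
  reduceLs-atomic []      h = h
  reduceLs-atomic (φ ∷ Γ) h = reduceL-atomic φ (reduceLs-atomic Γ h)

module GentzenProperties {_⊢_ : Relation} (G : IsGentzen _⊢_) where
  open IsGentzen G

  ⊢-trans : ∀ {S T s} → (∀ t → T t → S ⊢ t) → T ⊢ s → S ⊢ s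
  ⊢-trans {S} {T} {s} S⊢T T⊢s =
    monotone (cut {S′ = λ _ → ⊥} S⊢T (monotone T⊢s (λ _ → inj₁)))
             (λ { _ (inj₁ x) → x ; _ (inj₂ ()) })

  apply₁ : ∀ {S s t} → fromList (s ∷ []) ⊢ t → S ⊢ s → S ⊢ t
  apply₁ r S⊢s = ⊢-trans (λ { _ (here refl) → S⊢s }) r

  through : ∀ {s s′ t} → fromList (s ∷ []) ⊢ s′ → ｛ s′ ｝ ⊢ t → ｛ s ｝ ⊢ t
  through r s′⊢t = ⊢-trans (λ { _ refl → apply₁ r (reflexive _) }) s′⊢t

module ExtensionProperties {_⊢_ : Relation} (ext : ExtensionOfGB _⊢_) where
  open IsGentzen (proj₁ ext)
  open GentzenProperties (proj₁ ext)

  private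
    C : Contains GB _⊢_
    C = proj₂ ext

  record Interderivable (s : Sequent) (L : List Sequent) : Set₁ where
    field
      derives-each  : ∀ t → t ∈ L → ｛ s ｝ ⊢ t
      derived-from  : fromList L ⊢ s
  open Interderivable

  by-inversion : ∀ {s s′ L} → fromList (s ∷ []) ⊢ s′ → fromList (s′ ∷ []) ⊢ s →
                 Interderivable s′ L → Interderivable s L
  by-inversion elim intro e = record
    { derives-each = λ t t∈L → through elim (derives-each e t t∈L)
    ; derived-from = apply₁ intro (derived-from e) }

  by-branching : ∀ {s s₁ s₂ L₁ L₂} → fromList (s ∷ []) ⊢ s₁ → fromList (s ∷ []) ⊢ s₂ →
                 fromList (s₁ ∷ s₂ ∷ []) ⊢ s →
                 Interderivable s₁ L₁ → Interderivable s₂ L₂ → Interderivable s (L₁ ++ L₂)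
  by-branching {L₁ = L₁} elim₁ elim₂ intro e₁ e₂ = record
    { derives-each = λ t t∈L → [ (λ t∈L₁ → through elim₁ (derives-each e₁ t t∈L₁))
                                   , (λ t∈L₂ → through elim₂ (derives-each e₂ t t∈L₂)) ]′
                                   (∈-++⁻ L₁ t∈L)
    ; derived-from = ⊢-trans
        (λ { _ (here refl)         → monotone (derived-from e₁) (λ _ → ∈-++⁺ˡ)
           ; _ (there (here refl)) → monotone (derived-from e₂) (λ _ → ∈-++⁺ʳ L₁) })
        intro }

  by-axiom : ∀ {s} → fromList [] ⊢ s → Interderivable s []
  by-axiom ⊢s = record { derives-each = λ _ () ; derived-from = ⊢s }

  weaken : ∀ Γ Δ {Γ₀ Δ₀} → fromList [] ⊢ (Γ₀ ▷ Δ₀) → fromList [] ⊢ (Γ ++ Γ₀ ▷ Δ ++ Δ₀)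
  weaken []      []      ⊢s = ⊢s
  weaken []      (δ ∷ Δ) {Γ₀} {Δ₀} ⊢s = apply₁ (C (WR Γ₀ (Δ ++ Δ₀) δ)) (weaken [] Δ ⊢s)
  weaken (γ ∷ Γ) Δ       {Γ₀} {Δ₀} ⊢s = apply₁ (C (WL (Γ ++ Γ₀) (Δ ++ Δ₀) γ)) (weaken Γ Δ ⊢s)

  ⊤R-derivable : ∀ Γ Δ → fromList [] ⊢ (Γ ▷ ⊤′ ∷ Δ)
  ⊤R-derivable Γ Δ =
    apply₁ (C (Ex _ _ Γ (⊤′ ∷ Δ) (↭-reflexive (++-identityʳ Γ)) (++-comm Δ (⊤′ ∷ []))))
           (weaken Γ Δ (C ⊤ax))

  ⊥L-derivable : ∀ Γ Δ → fromList [] ⊢ (⊥′ ∷ Γ ▷ Δ)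
  ⊥L-derivable Γ Δ =
    apply₁ (C (Ex _ _ (⊥′ ∷ Γ) Δ (++-comm Γ (⊥′ ∷ [])) (↭-reflexive (++-identityʳ Δ))))
           (weaken Γ Δ (C ⊥ax))

  -- Γ ▷ Δ is what remains to be reduced; the atoms A, B split off so far sit at the ends.
  Reduces : Sequent → Continuation → Set₁
  Reduces (Γ ▷ Δ) k = ∀ A B → Interderivable (Γ ++ atoms A ▷ Δ ++ atoms B) (k A B)

  mutual
    reduceL-reduces : ∀ φ Γ Δ {k} → Reduces (Γ ▷ Δ) k → Reduces (φ ∷ Γ ▷ Δ) (reduceL φ k)
    reduceL-reduces (atom a) Γ Δ h A B =
      by-inversion (C (Ex _ _ _ _ (↭-sym (shift (atom a) Γ (atoms A))) ↭-refl))
                   (C (Ex _ _ _ _ (shift (atom a) Γ (atoms A)) ↭-refl))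
                   (h (a ∷ A) B)
    reduceL-reduces (φ ∧′ ψ) Γ Δ h A B =
      by-inversion (C (∧L-e _ _ φ ψ)) (C (∧L _ _ φ ψ))
                   (reduceL-reduces φ (ψ ∷ Γ) Δ (reduceL-reduces ψ Γ Δ h) A B)
    reduceL-reduces (φ ∨′ ψ) Γ Δ h A B =
      by-branching (C (∨L-e₁ _ _ φ ψ)) (C (∨L-e₂ _ _ φ ψ)) (C (∨L _ _ φ ψ))
                   (reduceL-reduces φ Γ Δ h A B) (reduceL-reduces ψ Γ Δ h A B)
    reduceL-reduces (─ φ) Γ Δ h A B =
      by-inversion (C (─L-e _ _ φ)) (C (─L _ _ φ)) (reduceR-reduces φ Γ Δ h A B)
    reduceL-reduces ⊤′ Γ Δ h A B =
      by-inversion (C (⊤-e _ _)) (C (WL _ _ ⊤′)) (h A B)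
    reduceL-reduces ⊥′ Γ Δ h A B = by-axiom (⊥L-derivable _ _)

    reduceR-reduces : ∀ φ Γ Δ {k} → Reduces (Γ ▷ Δ) k → Reduces (Γ ▷ φ ∷ Δ) (reduceR φ k)
    reduceR-reduces (atom a) Γ Δ h A B =
      by-inversion (C (Ex _ _ _ _ ↭-refl (↭-sym (shift (atom a) Δ (atoms B)))))
                   (C (Ex _ _ _ _ ↭-refl (shift (atom a) Δ (atoms B))))
                   (h A (a ∷ B))
    reduceR-reduces (φ ∧′ ψ) Γ Δ h A B =
      by-branching (C (∧R-e₁ _ _ φ ψ)) (C (∧R-e₂ _ _ φ ψ)) (C (∧R _ _ φ ψ))
                   (reduceR-reduces φ Γ Δ h A B) (reduceR-reduces ψ Γ Δ h A B)
    reduceR-reduces (φ ∨′ ψ) Γ Δ h A B =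
      by-inversion (C (∨R-e _ _ φ ψ)) (C (∨R _ _ φ ψ))
                   (reduceR-reduces φ Γ (ψ ∷ Δ) (reduceR-reduces ψ Γ Δ h) A B)
    reduceR-reduces (─ φ) Γ Δ h A B =
      by-inversion (C (─R-e _ _ φ)) (C (─R _ _ φ)) (reduceL-reduces φ Γ Δ h A B)
    reduceR-reduces ⊤′ Γ Δ h A B = by-axiom (⊤R-derivable _ _)
    reduceR-reduces ⊥′ Γ Δ h A B =
      by-inversion (C (⊥-e _ _)) (C (WR _ _ ⊥′)) (h A B)

  atomicReducts-interderivable : ∀ s → Interderivable s (atomicReducts s)
  atomicReducts-interderivable (Γ ▷ Δ) =
    subst (λ s → Interderivable s (atomicReducts (Γ ▷ Δ)))
          (cong₂ _▷_ (++-identityʳ Γ) (++-identityʳ Δ))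
          (reduceLs-reduces Γ Δ [] [])
    where
    atomicLeaf-reduces : Reduces ([] ▷ []) atomicLeaf
    atomicLeaf-reduces A B = record
      { derives-each = λ { _ (here refl) → reflexive _ }
      ; derived-from = monotone (reflexive _) (λ _ → here) }

    reduceRs-reduces : ∀ Δ → Reduces ([] ▷ Δ) (reduceRs Δ atomicLeaf)
    reduceRs-reduces []      = atomicLeaf-reduces
    reduceRs-reduces (φ ∷ Δ) = reduceR-reduces φ [] Δ (reduceRs-reduces Δ)

    reduceLs-reduces : ∀ Γ Δ → Reduces (Γ ▷ Δ) (reduceLs Γ (reduceRs Δ atomicLeaf))
    reduceLs-reduces []      Δ = reduceRs-reduces Δ
    reduceLs-reduces (φ ∷ Γ) Δ = reduceL-reduces φ Γ Δ (reduceLs-reduces Γ Δ)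

  atomicReductsOf-derives : ∀ S s → S s → atomicReductsOf S ⊢ s
  atomicReductsOf-derives S s Ss =
    monotone (derived-from (atomicReducts-interderivable s)) (λ t t∈s → s , Ss , t∈s)

  atomicReduct-derivable : ∀ {S s t} → S ⊢ s → t ∈ atomicReducts s → atomicReductsOf S ⊢ t
  atomicReduct-derivable {S} {s} {t} S⊢s t∈s =
    ⊢-trans (atomicReductsOf-derives S)
      (⊢-trans (λ { _ refl → S⊢s }) (derives-each (atomicReducts-interderivable s) t t∈s))

  derivable-from-atomicReducts : ∀ {S s} → (∀ t → t ∈ atomicReducts s → atomicReductsOf S ⊢ t) →
                                 S ⊢ s
  derivable-from-atomicReducts {S} {s} h =
    ⊢-trans (λ t t∈s → ⊢-trans reducts-derivable (h t t∈s))
            (derived-from (atomicReducts-interderivable s))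
    where
    reducts-derivable : ∀ u → atomicReductsOf S u → S ⊢ u
    reducts-derivable u (v , Sv , u∈v) =
      monotone (derives-each (atomicReducts-interderivable v) u u∈v) (λ { _ refl → Sv })

module ReductRules {J : Set₁} (P : J → SeqSet) (c : J → Sequent) where

  ReductIndex : Set₁
  ReductIndex = Σ J λ j → Σ Sequent λ t → t ∈ atomicReducts (c j)

  reductRules : ReductIndex → Rule
  reductRules (j , t , _) = rule (atomicReductsOf (P j)) t

  reductRules-structural : ∀ i → StructuralRule (reductRules i)
  reductRules-structural (j , t , t∈c) =
    (λ { u (v , _ , u∈v) → atomicReducts-atomic v u u∈v }) , atomicReducts-atomic (c j) t t∈c

  reductRules-axiomatize : ∀ {_⊢_} → ExtensionOfGB _⊢_ → (∀ j → P j ⊢ c j) →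
                           (∀ {S s} → S ⊢ s → Σ J λ j → P j ⊆ₛ S × c j ≡ s) →
                           Axiomatizes (GB+ reductRules) _⊢_
  reductRules-axiomatize {_⊢_} ext@(G , C) P⊢c covered = G , contains , least
    where
    contains : Contains (GB+ reductRules) _⊢_
    contains (inj₁ g)             = C g
    contains (inj₂ (j , t , t∈c)) = ExtensionProperties.atomicReduct-derivable ext (P⊢c j) t∈c

    least : ∀ _⊢′_ → IsGentzen _⊢′_ → Contains (GB+ reductRules) _⊢′_ → ∀ S s → S ⊢ s → S ⊢′ s
    least _⊢′_ G′ C′ S s S⊢s with covered S⊢s
    ... | j , Pj⊆S , refl =
      IsGentzen.monotone G′
        (ExtensionProperties.derivable-from-atomicReducts (G′ , λ g → C′ (inj₁ g))
           (λ t t∈c → C′ (inj₂ (j , t , t∈c))))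
        Pj⊆S

Judgement : Relation → Set₁
Judgement _⊢_ = Σ (SeqSet × Sequent) λ (S , s) → S ⊢ s

FinitaryJudgement : Relation → Set₁
FinitaryJudgement _⊢_ = Σ (List Sequent × Sequent) λ (L , s) → fromList L ⊢ s

extension-axiomatizable-by-structural-rules : ∀ (_⊢_ : Relation) → ExtensionOfGB _⊢_ →
  Σ Set₁ λ I → Σ (I → Rule) λ rs → (∀ i → StructuralRule (rs i)) × Axiomatizes (GB+ rs) _⊢_
extension-axiomatizable-by-structural-rules _⊢_ ext =
  ReductIndex , reductRules , reductRules-structural ,
  reductRules-axiomatize ext proj₂ (λ S⊢s → (_ , S⊢s) , (λ _ Ss → Ss) , refl)
  where open ReductRules {Judgement _⊢_} (proj₁ ∘ proj₁) (proj₂ ∘ proj₁)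

finitary-extension-axiomatizable-by-finitary-structural-rules :
  ∀ (_⊢_ : Relation) → ExtensionOfGB _⊢_ → Finitary _⊢_ →
  Σ Set₁ λ I → Σ (I → Rule) λ rs →
    (∀ i → StructuralRule (rs i) × FinitaryRule (rs i)) × Axiomatizes (GB+ rs) _⊢_
finitary-extension-axiomatizable-by-finitary-structural-rules _⊢_ ext fin =
  ReductIndex , reductRules ,
  (λ i → reductRules-structural i , finitePremises i) ,
  reductRules-axiomatize ext proj₂ covered
  where
  open ReductRules {FinitaryJudgement _⊢_} (fromList ∘ proj₁ ∘ proj₁) (proj₂ ∘ proj₁)

  finitePremises : ∀ i → FinitaryRule (reductRules i)
  finitePremises (((L , _) , _) , _) = concatMap atomicReducts L , atomicReductsOf-fromList L

  covered : ∀ {S s} → S ⊢ s →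
            Σ (FinitaryJudgement _⊢_) λ ((L , s′) , _) → fromList L ⊆ₛ S × s′ ≡ s
  covered S⊢s with fin S⊢s
  ... | L , L⊆S , L⊢s = (_ , L⊢s) , L⊆S , refl

proposition3p3 :
    (∀ (_⊢_ : Relation) → ExtensionOfGB _⊢_ →
       Σ Set₁ λ I → Σ (I → Rule) λ rs →
         (∀ i → StructuralRule (rs i)) × Axiomatizes (GB+ rs) _⊢_)
    ×
    (∀ (_⊢_ : Relation) → ExtensionOfGB _⊢_ → Finitary _⊢_ →
       Σ Set₁ λ I → Σ (I → Rule) λ rs →
         (∀ i → StructuralRule (rs i) × FinitaryRule (rs i)) × Axiomatizes (GB+ rs) _⊢_)
proposition3p3 =
  extension-axiomatizable-by-structural-rules ,
  finitary-extension-axiomatizable-by-finitary-structural-rules
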